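{- Let $T$ be a tree of order $n$. Then $$\frac{n+2\gamma(T)}{3}\le \operatorname{avd}(T)\le\frac{n+2\Gamma(T)}{3}.$$
   Context: A dominating set of a graph $G=(V,E)$ is a set $S\subseteq V$ such that every vertex is in $S$ or adjacent to a vertex of $S$; it is minimal if no proper subset is dominating. $\gamma(G)$ is the minimum size of a dominating set and $\Gamma(G)$ the maximum size of a minimal dominating set. If $\mathcal{D}(G)$ is the collection of all dominating sets of $G$, then $\operatorname{avd}(G)=\sum_{S\in\mathcal{D}(G)}|S|/|\mathcal{D}(G)|$ is the average size of a dominating set. -}

module Defs where

open import Data.Nat using (ℕ; zero; suc; _+_; _*_; _<_; _<?_)
open import Data.Bool using (Bool; true; false; T)
open import Data.Fin using (Fin; toℕ)
open import Data.Fin.Properties using (any?; all?)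
open import Data.Fin.Subset using (Subset; _∈_; _⊂_; ∣_∣; outside; inside)
open import Data.Fin.Subset.Properties using (_∈?_)
open import Data.Vec using (Vec; []; _∷_)
open import Data.List using (List; []; _∷_; map; _++_; filter; length; concatMap; allFin)
open import Data.Nat.ListAction using (sum)
open import Data.Product using (Σ; ∃; _×_; _,_)
open import Data.Sum using (_⊎_)
open import Relation.Nullary using (¬_; Dec)
open import Relation.Nullary.Decidable using (_⊎-dec_; _×-dec_)
open import Relation.Binary.PropositionalEquality using (_≡_)

record Graph (n : ℕ) : Set where
  field
    adj       : Fin n → Fin n → Bool
    symmetric : ∀ u v → adj u v ≡ adj v u
    irreflexive : ∀ v → adj v v ≡ false

open Graph public

Adj : ∀ {n} → Graph n → Fin n → Fin n → Set
Adj G u v = T (adj G u v)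

data Walk {n : ℕ} (G : Graph n) : Fin n → Fin n → Set where
  here : ∀ {v} → Walk G v v
  step : ∀ {u w v} → Adj G u w → Walk G w v → Walk G u v

Connected : ∀ {n} → Graph n → Set
Connected {n} G = (u v : Fin n) → Walk G u v

edges : ∀ {n} → Graph n → List (Fin n × Fin n)
edges {n} G =
  filter (λ p → let (i , j) = p in (toℕ i <? toℕ j) ×-dec Data.Bool.T? (adj G i j))
    (concatMap (λ i → map (λ j → (i , j)) (allFin n)) (allFin n))
  where import Data.Bool

IsTree : ∀ {n} → Graph n → Set
IsTree {n} G = Connected G × (length (edges G) + 1 ≡ n)

Dominating : ∀ {n} → Graph n → Subset n → Set
Dominating {n} G S = (v : Fin n) → v ∈ S ⊎ ∃ (λ u → u ∈ S × Adj G v u)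

dominating? : ∀ {n} (G : Graph n) (S : Subset n) → Dec (Dominating G S)
dominating? G S = all? (λ v → (v ∈? S) ⊎-dec any? (λ u → (u ∈? S) ×-dec Data.Bool.T? (adj G v u)))
  where import Data.Bool

MinimalDominating : ∀ {n} → Graph n → Subset n → Set
MinimalDominating G S = Dominating G S × (∀ S' → S' ⊂ S → ¬ Dominating G S')

IsDominationNumber : ∀ {n} → Graph n → ℕ → Set
IsDominationNumber G g =
  ∃ (λ S → Dominating G S × ∣ S ∣ ≡ g) × (∀ S → Dominating G S → g Data.Nat.≤ ∣ S ∣)
  where import Data.Nat

IsUpperDominationNumber : ∀ {n} → Graph n → ℕ → Set
IsUpperDominationNumber G g =
  ∃ (λ S → MinimalDominating G S × ∣ S ∣ ≡ g) × (∀ S → MinimalDominating G S → ∣ S ∣ Data.Nat.≤ g)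
  where import Data.Nat

allSubsets : (n : ℕ) → List (Subset n)
allSubsets zero = [] ∷ []
allSubsets (suc n) = map (outside ∷_) (allSubsets n) ++ map (inside ∷_) (allSubsets n)

dominatingSets : ∀ {n} → Graph n → List (Subset n)
dominatingSets {n} G = filter (dominating? G) (allSubsets n)

-- |𝒟(G)| and Σ_{S ∈ 𝒟(G)} |S|;  avd(G) = domSizeSum G / numDominating G.
numDominating : ∀ {n} → Graph n → ℕ
numDominating G = length (dominatingSets G)

domSizeSum : ∀ {n} → Graph n → ℕ
domSizeSum G = sum (map ∣_∣ (dominatingSets G))

-- Call x ∈ S redundant when S - x still dominates, and let r(S) be the number of
-- redundant vertices of S.  Pairing (S, v) for v ∉ S with (S ∪ {v}, v) shows that
-- Σ (n - |S|) = Σ r(S) over all dominating sets S, so the theorem follows from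
-- 2γ + r(S) ≤ 2|S| ≤ 2Γ + r(S) for every dominating set S of the tree.
--
-- Lower bound: the tree can be 2-coloured so that every closed neighbourhood meeting S
-- in two vertices meets both colours.  Deleting from S its redundant vertices of one
-- colour then leaves a dominating set, and the two colours give two dominating sets
-- of total size 2|S| - r(S).
--
-- Upper bound: an irredundant vertex of S has a private neighbour outside S or no
-- neighbour in S.  For each side of the bipartition of the tree, the vertices of S
-- and the private neighbours on that side, together with the vertices of S on the
-- other side having neither neighbours in S nor private neighbours, form an
-- independent set, of size ≤ Γ.  The two sides have total size ≥ 2|S| - r(S).

{-# OPTIONS --safe #-}
module Submission where

open import Defs
open import Data.Nat using (ℕ; zero; suc; _+_; _*_; _≤_; _<_; z≤n; s≤s; _<?_)
import Data.Nat as ℕ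
open import Data.Nat.Properties
  using ( ≤-refl; ≤-reflexive; ≤-trans; ≤-antisym; ≤-pred; <-irrefl; <⇒≱; ≮⇒≥; <-cmp
        ; n<1+n; m≤m+n; m≤n+m; +-identityʳ; +-suc; +-comm; +-assoc; *-zeroʳ; *-suc; *-distribˡ-+; suc-injective; m≢1+n+m
        ; +-mono-≤; +-monoˡ-≤; +-monoʳ-≤; +-cancelʳ-≤; module ≤-Reasoning
        ; +-0-commutativeMonoid; +-commutativeSemigroup )
open import Data.Nat.Solver using (module +-*-Solver)
open import Data.Nat.ListAction using (sum)
open import Data.Nat.ListAction.Properties using (sum-++)
open import Algebra.Properties.CommutativeMonoid.Sum +-0-commutativeMonoid
  using (sum-syntax; sum-cong-≗; ∑-distrib-+; ∑-comm; sum-replicate-zero)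
open import Algebra.Properties.CommutativeSemigroup +-commutativeSemigroup using (interchange)
open import Data.Product using (_×_; _,_; ∃; ∃-syntax; proj₁; proj₂)
open import Data.Sum using (_⊎_; inj₁; inj₂; [_,_]; swap)
open import Data.Empty using (⊥; ⊥-elim)
open import Data.Bool using (Bool; true; false; not; _∧_; _∨_; _xor_; if_then_else_; T; T?)
open import Data.Bool.Properties using (∧-identityʳ; ∧-zeroʳ; ∧-conicalˡ; ∧-conicalʳ; not-injective; not-¬)
open import Data.Fin using (Fin; zero; suc; toℕ; punchOut; _≟_)
import Data.Fin.Properties as Fin
open import Data.Fin.Properties using (any?; all?; ¬∀⟶∃¬; toℕ-injective; punchOut-injective; injective⇒≤)
open import Data.Fin.Subset using (Subset; outside; inside; ∣_∣; _∈_; _∉_; _⊆_; _⊂_) renaming (⊥ to ∅)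
open import Data.Fin.Subset.Properties using (_∈?_; ∉⊥)
open import Data.Vec using ([]; _∷_; lookup; tabulate; _[_]≔_; here; there)
open import Data.Vec.Properties
  using ( tabulate∘lookup; lookup∘tabulate; []=⇒lookup; lookup⇒[]=; []=-injective
        ; []≔-updates; []≔-minimal; lookup∘update′ )
open import Data.List using (List; []; _∷_; map; filter; length; _++_; allFin)
open import Data.List.Properties using (map-++; map-∘)
import Data.List.Membership.Propositional as List
open import Data.List.Membership.Propositional.Properties
  using (∈-map⁺; ∈-++⁺ˡ; ∈-++⁺ʳ; ∈-filter⁺; ∈-concatMap⁺; ∈-allFin)
open import Data.List.Membership.Setoid.Properties using (index-injective)
open import Data.List.Relation.Unary.All as All using (All; []; _∷_)
open import Data.List.Relation.Unary.All.Properties using (all-filter)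
open import Data.List.Relation.Unary.Any as Any using (here; index)
open import Data.List.Extrema.Nat using (argmax; argmax-all; f[xs]≤f[argmax])
open import Function using (_∘_; const)
open import Level using (0ℓ)
open import Relation.Nullary using (Dec; yes; no; does; ¬_; contradiction)
open import Relation.Nullary.Decidable using (dec-true; dec-false; _×-dec_; _⊎-dec_; _→-dec_; ¬?)
open import Relation.Unary using (Pred; Decidable)
open import Relation.Binary.Definitions using (tri<; tri≈; tri>)
open import Relation.Binary.PropositionalEquality
  using (_≡_; _≢_; refl; sym; trans; cong; cong₂; subst; subst₂; setoid; module ≡-Reasoning)

𝟙 : Bool → ℕ
𝟙 b = if b then 1 else 0

count : ∀ {n} → (Fin n → Bool) → ℕ
count {n} p = ∑[ x < n ] 𝟙 (p x)

∑-mono : ∀ {n} {f g : Fin n → ℕ} → (∀ x → f x ≤ g x) → ∑[ x < n ] f x ≤ ∑[ x < n ] g x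
∑-mono {zero}  f≤g = z≤n
∑-mono {suc n} f≤g = +-mono-≤ (f≤g zero) (∑-mono (f≤g ∘ suc))

count-cong : ∀ {n} {p q : Fin n → Bool} → (∀ x → p x ≡ q x) → count p ≡ count q
count-cong p≗q = sum-cong-≗ (cong 𝟙 ∘ p≗q)

count-none : ∀ {n} (p : Fin n → Bool) → (∀ x → p x ≡ false) → count p ≡ 0
count-none {n} p none = trans (count-cong none) (sum-replicate-zero n)

count-witness : ∀ {n} {p : Fin n → Bool} x → p x ≡ true → 1 ≤ count p
count-witness zero px = ≤-trans (≤-reflexive (cong 𝟙 (sym px))) (m≤m+n _ _)
count-witness {p = p} (suc x) px = ≤-trans (count-witness x px) (m≤n+m _ (𝟙 (p zero)))

count≤1 : ∀ {n} (p : Fin n → Bool) → (∀ {x y} → p x ≡ true → p y ≡ true → x ≡ y) → count p ≤ 1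
count≤1 {zero}  p unique = z≤n
count≤1 {suc n} p unique with p zero in p0
... | true  = ≤-reflexive (cong suc (count-none (p ∘ suc) others))
  where
  others : ∀ x → p (suc x) ≡ false
  others x with p (suc x) in px
  ... | false = refl
  ... | true  with () ← unique p0 px
... | false = count≤1 (p ∘ suc) (λ px py → Fin.suc-injective (unique px py))

count+count-not : ∀ {n} (p : Fin n → Bool) → count p + count (not ∘ p) ≡ n
count+count-not {zero}  p = refl
count+count-not {suc n} p with p zero
... | true  = cong suc (count+count-not (p ∘ suc))
... | false = trans (+-suc _ _) (cong suc (count+count-not (p ∘ suc)))

does≡true⇒ : ∀ {A : Set} (a? : Dec A) → does a? ≡ true → A
does≡true⇒ (yes a) _ = a

does≡false⇒¬ : ∀ {A : Set} (a? : Dec A) → does a? ≡ false → ¬ A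
does≡false⇒¬ (no ¬a) _ = ¬a

module _ {n} {P : Pred (Fin n) 0ℓ} (P? : Decidable P) where

  𝟙-any≤count : 𝟙 (does (any? P?)) ≤ count (does ∘ P?)
  𝟙-any≤count with any? P?
  ... | yes (x , px) = count-witness x (dec-true (P? x) px)
  ... | no _         = z≤n

  count≤𝟙-any : (∀ {x y} → P x → P y → x ≡ y) → count (does ∘ P?) ≤ 𝟙 (does (any? P?))
  count≤𝟙-any unique with any? P?
  ... | yes _  = count≤1 (does ∘ P?) λ {x} {y} px py → unique (does≡true⇒ (P? x) px) (does≡true⇒ (P? y) py)
  ... | no ¬∃P = ≤-reflexive (count-none (does ∘ P?) λ x → dec-false (P? x) (¬∃P ∘ (x ,_)))

module _ {m n} {R : Fin m → Fin n → Set} (R? : ∀ w u → Dec (R w u))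
         (functional : ∀ {w u u′} → R w u → R w u′ → u ≡ u′) where

  count-range≤count-domain : count (λ u → does (any? (λ w → R? w u))) ≤ count (λ w → does (any? (R? w)))
  count-range≤count-domain = begin
    count (λ u → does (any? (λ w → R? w u)))     ≤⟨ ∑-mono (λ u → 𝟙-any≤count (λ w → R? w u)) ⟩
    ∑[ u < n ] ∑[ w < m ] 𝟙 (does (R? w u))     ≡⟨ ∑-comm (λ u w → 𝟙 (does (R? w u))) ⟩
    ∑[ w < m ] ∑[ u < n ] 𝟙 (does (R? w u))     ≤⟨ ∑-mono (λ w → count≤𝟙-any (R? w) functional) ⟩
    count (λ w → does (any? (R? w)))             ∎
    where open ≤-Reasoning

∣tabulate∣ : ∀ {n} (p : Fin n → Bool) → ∣ tabulate p ∣ ≡ count p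
∣tabulate∣ {zero}  p = refl
∣tabulate∣ {suc n} p with p zero
... | true  = cong suc (∣tabulate∣ (p ∘ suc))
... | false = ∣tabulate∣ (p ∘ suc)

∣S∣≡count : ∀ {n} (S : Subset n) → ∣ S ∣ ≡ count (lookup S)
∣S∣≡count S = trans (cong ∣_∣ (sym (tabulate∘lookup S))) (∣tabulate∣ (lookup S))

∈-remove⁻ : ∀ {n} {S : Subset n} {v x} → x ∈ S [ v ]≔ outside → x ≢ v × x ∈ S
∈-remove⁻ {S = S} {v} {x} x∈S′ =
  x≢v , lookup⇒[]= x S (trans (sym (lookup∘update′ x≢v S outside)) ([]=⇒lookup x∈S′))
  where
  x≢v : x ≢ v
  x≢v refl with () ← []=-injective x∈S′ ([]≔-updates S v)

∈-remove⁺ : ∀ {n} {S : Subset n} {v x} → x ∈ S → x ≢ v → x ∈ S [ v ]≔ outside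
∈-remove⁺ {S = S} {v} {x} x∈S x≢v = []≔-minimal S x v x≢v x∈S

∈-insert⁻ : ∀ {n} {S : Subset n} {v x} → x ∈ S [ v ]≔ inside → x ≡ v ⊎ x ∈ S
∈-insert⁻ {S = S} {v} {x} x∈S′ with x ≟ v
... | yes x≡v = inj₁ x≡v
... | no  x≢v = inj₂ (lookup⇒[]= x S (trans (sym (lookup∘update′ x≢v S inside)) ([]=⇒lookup x∈S′)))

∣insert∣ : ∀ {n} (S : Subset n) {v} → v ∉ S → ∣ S [ v ]≔ inside ∣ ≡ suc ∣ S ∣
∣insert∣ (outside ∷ S) {zero}  v∉S = refl
∣insert∣ (inside  ∷ S) {zero}  v∉S = contradiction here v∉S
∣insert∣ (outside ∷ S) {suc v} v∉S = ∣insert∣ S (v∉S ∘ there)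
∣insert∣ (inside  ∷ S) {suc v} v∉S = cong suc (∣insert∣ S (v∉S ∘ there))

∈-tabulate⁺ : ∀ {n} {p : Fin n → Bool} {x} → p x ≡ true → x ∈ tabulate p
∈-tabulate⁺ {p = p} {x} px = lookup⇒[]= x (tabulate p) (trans (lookup∘tabulate p x) px)

∈-tabulate⁻ : ∀ {n} {p : Fin n → Bool} {x} → x ∈ tabulate p → p x ≡ true
∈-tabulate⁻ {p = p} {x} x∈ = trans (sym (lookup∘tabulate p x)) ([]=⇒lookup x∈)

∈-allSubsets : ∀ {n} (S : Subset n) → S List.∈ allSubsets n
∈-allSubsets []                    = here refl
∈-allSubsets {suc n} (outside ∷ S) = ∈-++⁺ˡ (∈-map⁺ (outside ∷_) (∈-allSubsets S))
∈-allSubsets {suc n} (inside ∷ S)  = ∈-++⁺ʳ _ (∈-map⁺ (inside ∷_) (∈-allSubsets S))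

∉⇒lookup≡false : ∀ {n} {S : Subset n} {x} → x ∉ S → lookup S x ≡ false
∉⇒lookup≡false {S = S} {x} x∉S with lookup S x in sx
... | false = refl
... | true  = contradiction (lookup⇒[]= x S sx) x∉S

-- Double counting over all subsets

sumSubsets : ∀ {n} → (Subset n → ℕ) → ℕ
sumSubsets {zero}  f = f []
sumSubsets {suc n} f = sumSubsets (f ∘ (outside ∷_)) + sumSubsets (f ∘ (inside ∷_))

sumSubsets-cong : ∀ {n} {f g : Subset n → ℕ} → (∀ S → f S ≡ g S) → sumSubsets f ≡ sumSubsets g
sumSubsets-cong {zero}  f≗g = f≗g []
sumSubsets-cong {suc n} f≗g =
  cong₂ _+_ (sumSubsets-cong (f≗g ∘ (outside ∷_))) (sumSubsets-cong (f≗g ∘ (inside ∷_)))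

sumSubsets-zero : ∀ {n} → sumSubsets {n} (λ _ → 0) ≡ 0
sumSubsets-zero {zero}  = refl
sumSubsets-zero {suc n} = cong₂ _+_ (sumSubsets-zero {n}) (sumSubsets-zero {n})

sumSubsets-∑-comm : ∀ {n m} (f : Subset n → Fin m → ℕ) →
  sumSubsets (λ S → ∑[ v < m ] f S v) ≡ ∑[ v < m ] sumSubsets (λ S → f S v)
sumSubsets-∑-comm {zero}      f = refl
sumSubsets-∑-comm {suc n} {m} f = begin
  sumSubsets (λ S → ∑[ v < m ] f (outside ∷ S) v) + sumSubsets (λ S → ∑[ v < m ] f (inside ∷ S) v)
    ≡⟨ cong₂ _+_ (sumSubsets-∑-comm (f ∘ (outside ∷_))) (sumSubsets-∑-comm (f ∘ (inside ∷_))) ⟩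
  ∑[ v < m ] sumSubsets (λ S → f (outside ∷ S) v) + ∑[ v < m ] sumSubsets (λ S → f (inside ∷ S) v)
    ≡⟨ ∑-distrib-+ (λ v → sumSubsets (λ S → f (outside ∷ S) v))
                   (λ v → sumSubsets (λ S → f (inside ∷ S) v)) ⟨
  ∑[ v < m ] sumSubsets (λ S → f S v) ∎
  where open ≡-Reasoning

sumSubsets-flip : ∀ {n} (v : Fin n) (p : Subset n → Bool) →
  sumSubsets (λ S → 𝟙 (not (lookup S v) ∧ p S)) ≡ sumSubsets (λ S → 𝟙 (lookup S v ∧ p (S [ v ]≔ outside)))
sumSubsets-flip {suc n} zero    p = begin
  Σp + sumSubsets {n} (λ _ → 0) ≡⟨ cong (Σp +_) (sumSubsets-zero {n}) ⟩
  Σp + 0                        ≡⟨ +-comm Σp 0 ⟩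
  0 + Σp                        ≡⟨ cong (_+ Σp) (sumSubsets-zero {n}) ⟨
  sumSubsets {n} (λ _ → 0) + Σp ∎
  where
  Σp = sumSubsets (λ S → 𝟙 (p (outside ∷ S)))
  open ≡-Reasoning
sumSubsets-flip {suc n} (suc v) p =
  cong₂ _+_ (sumSubsets-flip v (p ∘ (outside ∷_))) (sumSubsets-flip v (p ∘ (inside ∷_)))

sum-map-allSubsets : ∀ n (f : Subset n → ℕ) → sum (map f (allSubsets n)) ≡ sumSubsets f
sum-map-allSubsets zero    f = +-identityʳ (f [])
sum-map-allSubsets (suc n) f = begin
  sum (map f (map (outside ∷_) Ss ++ map (inside ∷_) Ss))
    ≡⟨ cong sum (map-++ f (map (outside ∷_) Ss) (map (inside ∷_) Ss)) ⟩
  sum (map f (map (outside ∷_) Ss) ++ map f (map (inside ∷_) Ss))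
    ≡⟨ sum-++ (map f (map (outside ∷_) Ss)) (map f (map (inside ∷_) Ss)) ⟩
  sum (map f (map (outside ∷_) Ss)) + sum (map f (map (inside ∷_) Ss))
    ≡⟨ cong₂ (λ xs ys → sum xs + sum ys) (map-∘ Ss) (map-∘ Ss) ⟨
  sum (map (f ∘ (outside ∷_)) Ss) + sum (map (f ∘ (inside ∷_)) Ss)
    ≡⟨ cong₂ _+_ (sum-map-allSubsets n (f ∘ (outside ∷_))) (sum-map-allSubsets n (f ∘ (inside ∷_))) ⟩
  sumSubsets f ∎
  where
  Ss = allSubsets n
  open ≡-Reasoning

sum-map-filter : ∀ {A : Set} {P : Pred A 0ℓ} (P? : Decidable P) (f : A → ℕ) xs →
  sum (map f (filter P? xs)) ≡ sum (map (λ x → if does (P? x) then f x else 0) xs)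
sum-map-filter P? f []       = refl
sum-map-filter P? f (x ∷ xs) with does (P? x)
... | true  = cong (f x +_) (sum-map-filter P? f xs)
... | false = sum-map-filter P? f xs

module _ {n} {P : Pred (Subset n) 0ℓ} (P? : Decidable P) where

  removable : Subset n → Fin n → Bool
  removable S v = lookup S v ∧ does (P? (S [ v ]≔ outside))

  familySum : (Subset n → ℕ) → ℕ
  familySum f = sum (map f (filter P? (allSubsets n)))

  familySum≡sumSubsets : ∀ f → familySum f ≡ sumSubsets (λ S → if does (P? S) then f S else 0)
  familySum≡sumSubsets f = trans (sum-map-filter P? f (allSubsets n)) (sum-map-allSubsets n _)

  -- Both sides count the pairs (S, v) with S in the family and v ∉ S, the right one through
  -- S ∪ {v}; up-closure makes its summand vanish outside the family.
  sum-complement≡sum-removable : (∀ S v → P (S [ v ]≔ outside) → P S) →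
    familySum (λ S → count (not ∘ lookup S)) ≡ familySum (λ S → count (removable S))
  sum-complement≡sum-removable P-up = begin
    familySum (λ S → count (not ∘ lookup S))
      ≡⟨ familySum≡sumSubsets _ ⟩
    sumSubsets (λ S → if does (P? S) then count (not ∘ lookup S) else 0)
      ≡⟨ sumSubsets-cong (λ S → if-count (does (P? S)) (not ∘ lookup S)) ⟩
    sumSubsets (λ S → ∑[ v < n ] 𝟙 (not (lookup S v) ∧ does (P? S)))
      ≡⟨ sumSubsets-∑-comm (λ S v → 𝟙 (not (lookup S v) ∧ does (P? S))) ⟩
    ∑[ v < n ] sumSubsets (λ S → 𝟙 (not (lookup S v) ∧ does (P? S)))
      ≡⟨ sum-cong-≗ (λ v → sumSubsets-flip v (does ∘ P?)) ⟩
    ∑[ v < n ] sumSubsets (λ S → 𝟙 (removable S v))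
      ≡⟨ sumSubsets-∑-comm (λ S v → 𝟙 (removable S v)) ⟨
    sumSubsets (λ S → count (removable S))
      ≡⟨ sumSubsets-cong removable-outside-family ⟩
    sumSubsets (λ S → if does (P? S) then count (removable S) else 0)
      ≡⟨ familySum≡sumSubsets _ ⟨
    familySum (λ S → count (removable S)) ∎
    where
    open ≡-Reasoning
    if-count : ∀ b (p : Fin n → Bool) → (if b then count p else 0) ≡ count (λ v → p v ∧ b)
    if-count true  p = count-cong (λ v → sym (∧-identityʳ (p v)))
    if-count false p = sym (count-none _ (λ v → ∧-zeroʳ (p v)))
    removable-outside-family : ∀ S → count (removable S) ≡ (if does (P? S) then count (removable S) else 0)
    removable-outside-family S with P? S
    ... | yes _  = refl
    ... | no ¬PS = count-none (removable S) λ v →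
          trans (cong (lookup S v ∧_) (dec-false (P? _) (¬PS ∘ P-up S v))) (∧-zeroʳ (lookup S v))

module _ {A : Set} where

  sum-map-+ : ∀ (f g : A → ℕ) xs → sum (map (λ x → f x + g x) xs) ≡ sum (map f xs) + sum (map g xs)
  sum-map-+ f g []       = refl
  sum-map-+ f g (x ∷ xs) = trans (cong (f x + g x +_) (sum-map-+ f g xs)) (interchange (f x) (g x) _ _)

  sum-map-*ˡ : ∀ k (f : A → ℕ) xs → sum (map (λ x → k * f x) xs) ≡ k * sum (map f xs)
  sum-map-*ˡ k f []       = sym (*-zeroʳ k)
  sum-map-*ˡ k f (x ∷ xs) = trans (cong (k * f x +_) (sum-map-*ˡ k f xs)) (sym (*-distribˡ-+ k (f x) _))

  sum-map-const : ∀ k (xs : List A) → sum (map (λ _ → k) xs) ≡ k * length xs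
  sum-map-const k []       = sym (*-zeroʳ k)
  sum-map-const k (x ∷ xs) = trans (cong (k +_) (sum-map-const k xs)) (sym (*-suc k (length xs)))

  sum-map-mono : ∀ {f g : A → ℕ} {xs} → All (λ x → f x ≤ g x) xs → sum (map f xs) ≤ sum (map g xs)
  sum-map-mono []           = z≤n
  sum-map-mono (fx≤gx ∷ le) = +-mono-≤ fx≤gx (sum-map-mono le)

module Averaging {A : Set} (xs : List A) (size coSize redundancy : A → ℕ) {n : ℕ}
  (size+coSize : ∀ x → size x + coSize x ≡ n)
  (∑coSize≡∑redundancy : sum (map coSize xs) ≡ sum (map redundancy xs)) where

  open +-*-Solver using (solve; _:=_; con; _:+_; _:*_)
  open ≤-Reasoning

  private
    Σsize = sum (map size xs)
    Σredundancy = sum (map redundancy xs)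

    spread : ∀ k → sum (map (λ x → k + redundancy x) xs) ≡ k * length xs + Σredundancy
    spread k = trans (sum-map-+ (λ _ → k) redundancy xs) (cong (_+ Σredundancy) (sum-map-const k xs))

    threefold : sum (map (λ x → 3 * size x + coSize x) xs) ≡ 3 * Σsize + Σredundancy
    threefold = trans (sum-map-+ (λ x → 3 * size x) coSize xs)
                      (cong₂ _+_ (sum-map-*ˡ 3 size xs) ∑coSize≡∑redundancy)

    3size+coSize≡n+2size : ∀ x → 3 * size x + coSize x ≡ n + 2 * size x
    3size+coSize≡n+2size x = trans (solve 2 (λ s c → con 3 :* s :+ c := (s :+ c) :+ con 2 :* s) refl (size x) (coSize x))
                        (cong (_+ 2 * size x) (size+coSize x))

  average-lower : ∀ k → All (λ x → 2 * k + redundancy x ≤ 2 * size x) xs →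
                  (n + 2 * k) * length xs ≤ 3 * Σsize
  average-lower k bound = +-cancelʳ-≤ Σredundancy _ _ (begin
    (n + 2 * k) * length xs + Σredundancy            ≡⟨ spread (n + 2 * k) ⟨
    sum (map (λ x → n + 2 * k + redundancy x) xs)   ≤⟨ sum-map-mono (All.map pointwise bound) ⟩
    sum (map (λ x → 3 * size x + coSize x) xs) ≡⟨ threefold ⟩
    3 * Σsize + Σredundancy                          ∎)
    where
    pointwise : ∀ {x} → 2 * k + redundancy x ≤ 2 * size x → n + 2 * k + redundancy x ≤ 3 * size x + coSize x
    pointwise {x} le = begin
      n + 2 * k + redundancy x   ≡⟨ +-assoc n (2 * k) (redundancy x) ⟩
      n + (2 * k + redundancy x) ≤⟨ +-monoʳ-≤ n le ⟩
      n + 2 * size x           ≡⟨ 3size+coSize≡n+2size x ⟨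
      3 * size x + coSize x ∎

  average-upper : ∀ k → All (λ x → 2 * size x ≤ 2 * k + redundancy x) xs →
                  3 * Σsize ≤ (n + 2 * k) * length xs
  average-upper k bound = +-cancelʳ-≤ Σredundancy _ _ (begin
    3 * Σsize + Σredundancy                          ≡⟨ threefold ⟨
    sum (map (λ x → 3 * size x + coSize x) xs) ≤⟨ sum-map-mono (All.map pointwise bound) ⟩
    sum (map (λ x → n + 2 * k + redundancy x) xs)   ≡⟨ spread (n + 2 * k) ⟩
    (n + 2 * k) * length xs + Σredundancy            ∎)
    where
    pointwise : ∀ {x} → 2 * size x ≤ 2 * k + redundancy x → 3 * size x + coSize x ≤ n + 2 * k + redundancy x
    pointwise {x} le = begin
      3 * size x + coSize x ≡⟨ 3size+coSize≡n+2size x ⟩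
      n + 2 * size x           ≤⟨ +-monoʳ-≤ n le ⟩
      n + (2 * k + redundancy x) ≡⟨ +-assoc n (2 * k) (redundancy x) ⟨
      n + 2 * k + redundancy x   ∎

module _ {n} (G : Graph n) where

  adj-sym : ∀ {u v} → Adj G u v → Adj G v u
  adj-sym {u} {v} = subst T (symmetric G u v)

  adj-irrefl : ∀ {u v} → Adj G u v → u ≢ v
  adj-irrefl {u} u~u refl = subst T (irreflexive G u) u~u

  DominatedBy : Subset n → Fin n → Set
  DominatedBy S v = v ∈ S ⊎ ∃ (λ u → u ∈ S × Adj G v u)

  dominatedBy? : ∀ S v → Dec (DominatedBy S v)
  dominatedBy? S v = (v ∈? S) ⊎-dec any? (λ u → (u ∈? S) ×-dec T? (adj G v u))

  Dominates : Fin n → Fin n → Set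
  Dominates x w = x ≡ w ⊎ Adj G w x

  dominator : ∀ {S} → Dominating G S → ∀ w → ∃[ x ] x ∈ S × Dominates x w
  dominator dom w with dom w
  ... | inj₁ w∈S             = w , w∈S , inj₁ refl
  ... | inj₂ (x , x∈S , w~x) = x , x∈S , inj₂ w~x

  dominated : ∀ {S x w} → x ∈ S → Dominates x w → DominatedBy S w
  dominated x∈S (inj₁ refl) = inj₁ x∈S
  dominated {x = x} x∈S (inj₂ w~x) = inj₂ (x , x∈S , w~x)

  dominating-⊆ : ∀ {S S′} → S ⊆ S′ → Dominating G S → Dominating G S′
  dominating-⊆ S⊆S′ dom w with dom w
  ... | inj₁ w∈S             = inj₁ (S⊆S′ w∈S)
  ... | inj₂ (x , x∈S , w~x) = inj₂ (x , S⊆S′ x∈S , w~x)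

  redundant : Subset n → Fin n → Bool
  redundant = removable (dominating? G)

  redundancy : Subset n → ℕ
  redundancy S = count (redundant S)

  removal-⊆ : ∀ (S : Subset n) v → S [ v ]≔ outside ⊆ S
  removal-⊆ S v x∈ = proj₂ (∈-remove⁻ {S = S} {v} x∈)

  -- Independent sets and the upper domination number

  Independent : Subset n → Set
  Independent X = ∀ x y → x ∈ X → y ∈ X → ¬ Adj G x y

  independent? : ∀ X → Dec (Independent X)
  independent? X = all? λ x → all? λ y → (x ∈? X) →-dec ((y ∈? X) →-dec ¬? (T? (adj G x y)))

  maximal-independent⇒minimal-dominating : ∀ {M} → Independent M →
    (∀ v → v ∉ M → ¬ Independent (M [ v ]≔ inside)) → MinimalDominating G M
  maximal-independent⇒minimal-dominating {M} M-ind maximal = dominates , minimal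
    where
    dominates : Dominating G M
    dominates v with v ∈? M
    ... | yes v∈M = inj₁ v∈M
    ... | no  v∉M with any? (λ u → (u ∈? M) ×-dec T? (adj G v u))
    ...   | yes neighbour = inj₂ neighbour
    ...   | no  no-neighbour = contradiction extended-independent (maximal v v∉M)
      where
      extended-independent : Independent (M [ v ]≔ inside)
      extended-independent x y x∈ y∈ x~y with ∈-insert⁻ x∈ | ∈-insert⁻ y∈
      ... | inj₁ refl | inj₁ refl = adj-irrefl x~y refl
      ... | inj₁ refl | inj₂ y∈M  = no-neighbour (y , y∈M , x~y)
      ... | inj₂ x∈M  | inj₁ refl = no-neighbour (x , x∈M , adj-sym x~y)
      ... | inj₂ x∈M  | inj₂ y∈M  = M-ind x y x∈M y∈M x~y
    minimal : ∀ S → S ⊂ M → ¬ Dominating G S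
    minimal S (S⊆M , x , x∈M , x∉S) dom with dom x
    ... | inj₁ x∈S             = x∉S x∈S
    ... | inj₂ (u , u∈S , x~u) = M-ind x u x∈M (S⊆M u∈S) x~u

  -- A maximum independent set is maximal, hence a minimal dominating set.
  independent≤Γ : ∀ {Γ X} → IsUpperDominationNumber G Γ → Independent X → ∣ X ∣ ≤ Γ
  independent≤Γ {Γ} {X} (_ , minimal≤Γ) X-ind =
    ≤-trans (≤-maximum X-ind) (minimal≤Γ M (maximal-independent⇒minimal-dominating M-ind M-maximal))
    where
    independents = filter independent? (allSubsets n)
    M = argmax ∣_∣ ∅ independents
    M-ind : Independent M
    M-ind = argmax-all ∣_∣ (λ _ _ x∈∅ → contradiction x∈∅ ∉⊥) (all-filter independent? (allSubsets n))
    ≤-maximum : ∀ {Y} → Independent Y → ∣ Y ∣ ≤ ∣ M ∣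
    ≤-maximum {Y} Y-ind =
      All.lookup (f[xs]≤f[argmax] ∅ independents) (∈-filter⁺ independent? (∈-allSubsets Y) Y-ind)
    M-maximal : ∀ v → v ∉ M → ¬ Independent (M [ v ]≔ inside)
    M-maximal v v∉M ind = <-irrefl refl (subst (_≤ ∣ M ∣) (∣insert∣ M v∉M) (≤-maximum ind))

  -- Pruning redundant vertices

  Splitting : Subset n → (Fin n → Bool) → Set
  Splitting S colour = ∀ {w x y} → x ∈ S → y ∈ S → x ≢ y → Dominates x w → Dominates y w →
                       ∃[ z ] z ∈ S × Dominates z w × colour z ≢ colour x

  splitting-not : ∀ {S colour} → Splitting S colour → Splitting S (not ∘ colour)
  splitting-not split x∈S y∈S x≢y x▹w y▹w with split x∈S y∈S x≢y x▹w y▹w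
  ... | z , z∈S , z▹w , cz≢cx = z , z∈S , z▹w , cz≢cx ∘ not-injective

  prune : Subset n → (Fin n → Bool) → Subset n
  prune S colour = tabulate (λ x → lookup S x ∧ not (redundant S x ∧ colour x))

  redundant⇒dominating : ∀ {S x} → redundant S x ≡ true → Dominating G (S [ x ]≔ outside)
  redundant⇒dominating {S} {x} red with lookup S x
  ... | true = does≡true⇒ (dominating? G _) red

  ∈-prune : ∀ {S colour x} → x ∈ S → redundant S x ∧ colour x ≡ false → x ∈ prune S colour
  ∈-prune x∈S kept = ∈-tabulate⁺ (cong₂ (λ a b → a ∧ not b) ([]=⇒lookup x∈S) kept)

  -- If the dominator x of w is pruned, S - x still dominates w through some y ≠ x,
  -- and splitting provides a dominator of w of the other colour, which is kept.
  prune-dominating : ∀ {S colour} → Dominating G S → Splitting S colour → Dominating G (prune S colour)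
  prune-dominating {S} {colour} dom split w with dominator dom w
  ... | x , x∈S , x▹w with redundant S x ∧ colour x in pruned
  ...   | false = dominated (∈-prune x∈S pruned) x▹w
  ...   | true with dominator (redundant⇒dominating (∧-conicalˡ _ _ pruned)) w
  ...     | y , y∈S′ , y▹w with ∈-remove⁻ y∈S′
  ...       | y≢x , y∈S with split x∈S y∈S (y≢x ∘ sym) x▹w y▹w
  ...         | z , z∈S , z▹w , cz≢cx =
    dominated (∈-prune z∈S (trans (cong (_ ∧_) (other-colour cz≢cx (∧-conicalʳ _ _ pruned))) (∧-zeroʳ _))) z▹w
    where
    other-colour : ∀ {a b} → a ≢ b → b ≡ true → a ≡ false
    other-colour {false} _   _    = refl
    other-colour {true}  a≢b refl = contradiction refl a≢b

  ∣prune∣+∣prune∣ : ∀ S colour →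
    ∣ prune S colour ∣ + ∣ prune S (not ∘ colour) ∣ + redundancy S ≡ ∣ S ∣ + ∣ S ∣
  ∣prune∣+∣prune∣ S colour = begin
    ∣ prune S colour ∣ + ∣ prune S (not ∘ colour) ∣ + redundancy S
      ≡⟨ cong₂ (λ a b → a + b + redundancy S) (∣tabulate∣ keep₁) (∣tabulate∣ keep₂) ⟩
    count keep₁ + count keep₂ + count rem
      ≡⟨ cong (_+ count rem) (∑-distrib-+ (𝟙 ∘ keep₁) (𝟙 ∘ keep₂)) ⟨
    ∑[ x < n ] (𝟙 (keep₁ x) + 𝟙 (keep₂ x)) + count rem
      ≡⟨ ∑-distrib-+ (λ x → 𝟙 (keep₁ x) + 𝟙 (keep₂ x)) (𝟙 ∘ rem) ⟨
    ∑[ x < n ] (𝟙 (keep₁ x) + 𝟙 (keep₂ x) + 𝟙 (rem x))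
      ≡⟨ sum-cong-≗ (λ x → two-prunings (lookup S x) _ (colour x)) ⟩
    ∑[ x < n ] (𝟙 (lookup S x) + 𝟙 (lookup S x))
      ≡⟨ ∑-distrib-+ (𝟙 ∘ lookup S) (𝟙 ∘ lookup S) ⟩
    count (lookup S) + count (lookup S)
      ≡⟨ cong₂ _+_ (∣S∣≡count S) (∣S∣≡count S) ⟨
    ∣ S ∣ + ∣ S ∣ ∎
    where
    open ≡-Reasoning
    rem = redundant S
    keep₁ = λ x → lookup S x ∧ not (rem x ∧ colour x)
    keep₂ = λ x → lookup S x ∧ not (rem x ∧ not (colour x))
    two-prunings : ∀ s d c →
      𝟙 (s ∧ not ((s ∧ d) ∧ c)) + 𝟙 (s ∧ not ((s ∧ d) ∧ not c)) + 𝟙 (s ∧ d) ≡ 𝟙 s + 𝟙 s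
    two-prunings false d     c     = refl
    two-prunings true  false c     = refl
    two-prunings true  true  false = refl
    two-prunings true  true  true  = refl

  2γ+redundancy≤2∣S∣ : ∀ {γ S colour} → IsDominationNumber G γ → Dominating G S → Splitting S colour →
                2 * γ + redundancy S ≤ 2 * ∣ S ∣
  2γ+redundancy≤2∣S∣ {γ} {S} {colour} (_ , γ≤) dom split = begin
    2 * γ + redundancy S
      ≡⟨ cong (λ k → γ + k + redundancy S) (+-identityʳ γ) ⟩
    γ + γ + redundancy S
      ≤⟨ +-monoˡ-≤ (redundancy S) (+-mono-≤ (γ≤ _ (prune-dominating dom split))
                                           (γ≤ _ (prune-dominating dom (splitting-not split)))) ⟩
    ∣ prune S colour ∣ + ∣ prune S (not ∘ colour) ∣ + redundancy S
      ≡⟨ ∣prune∣+∣prune∣ S colour ⟩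
    ∣ S ∣ + ∣ S ∣
      ≡⟨ cong (∣ S ∣ +_) (+-identityʳ ∣ S ∣) ⟨
    2 * ∣ S ∣ ∎
    where open ≤-Reasoning

  -- Private neighbours

  ProperColouring : (Fin n → Bool) → Set
  ProperColouring side = ∀ {u v} → Adj G u v → side u ≢ side v

  proper-not : ∀ {side} → ProperColouring side → ProperColouring (not ∘ side)
  proper-not proper u~v = proper u~v ∘ not-injective

  PrivateNeighbour : Subset n → Fin n → Fin n → Set
  PrivateNeighbour S w u = w ∉ S × u ∈ S × Adj G w u × (∀ u′ → u′ ∈ S → Adj G w u′ → u′ ≡ u)

  privateNeighbour? : ∀ S w u → Dec (PrivateNeighbour S w u)
  privateNeighbour? S w u = ¬? (w ∈? S) ×-dec (u ∈? S) ×-dec T? (adj G w u) ×-dec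
                            all? (λ u′ → (u′ ∈? S) →-dec (T? (adj G w u′) →-dec (u′ ≟ u)))

  NoNeighbourIn : Subset n → Fin n → Set
  NoNeighbourIn S u = ∀ u′ → u′ ∈ S → ¬ Adj G u u′

  irredundant⇒private⊎isolated : ∀ {S x} → Dominating G S → x ∈ S → ¬ Dominating G (S [ x ]≔ outside) →
                                    (∃[ w ] PrivateNeighbour S w x) ⊎ NoNeighbourIn S x
  irredundant⇒private⊎isolated {S} {x} dom x∈S ¬dom′
    with ¬∀⟶∃¬ n _ (dominatedBy? (S [ x ]≔ outside)) ¬dom′
  ... | w , ¬dom′w with dominator dom w
  ...   | x₁ , x₁∈S , x₁▹w with x₁ ≟ x
  ...     | no x₁≢x = contradiction (dominated (∈-remove⁺ x₁∈S x₁≢x) x₁▹w) ¬dom′w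
  ...     | yes refl with x₁▹w
  ...       | inj₁ refl = inj₂ λ u u∈S x~u →
                ¬dom′w (inj₂ (u , ∈-remove⁺ u∈S (adj-irrefl x~u ∘ sym) , x~u))
  ...       | inj₂ w~x  = inj₁ (w , w∉S , x∈S , w~x , unique)
    where
    w∉S : w ∉ S
    w∉S w∈S = ¬dom′w (inj₁ (∈-remove⁺ w∈S (adj-irrefl w~x)))
    unique : ∀ u → u ∈ S → Adj G w u → u ≡ x
    unique u u∈S w~u with u ≟ x
    ... | yes u≡x = u≡x
    ... | no  u≢x = contradiction (inj₂ (u , ∈-remove⁺ u∈S u≢x , w~u)) ¬dom′w

  privateNeighbour-unique : ∀ {S w u u′} → PrivateNeighbour S w u → PrivateNeighbour S w u′ → u ≡ u′
  privateNeighbour-unique (_ , _ , _ , unique) (_ , u′∈S , w~u′ , _) = sym (unique _ u′∈S w~u′)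

  module _ (S : Subset n) where

    isPrivate : Fin n → Bool
    isPrivate w = does (any? (privateNeighbour? S w))

    hasPrivate : Fin n → Bool
    hasPrivate u = does (any? (λ w → privateNeighbour? S w u))

    Lonely : Fin n → Set
    Lonely u = u ∈ S × NoNeighbourIn S u × ¬ (∃[ w ] PrivateNeighbour S w u)

    lonely? : ∀ u → Dec (Lonely u)
    lonely? u = (u ∈? S) ×-dec all? (λ u′ → (u′ ∈? S) →-dec ¬? (T? (adj G u u′))) ×-dec
                ¬? (any? (λ w → privateNeighbour? S w u))

    lonely : Fin n → Bool
    lonely = does ∘ lonely?

    sideSelection : (Fin n → Bool) → Subset n
    sideSelection side = tabulate (λ x → if side x then lookup S x ∨ isPrivate x else lonely x)

    lonely-no-neighbour : ∀ {x y} → lonely y ≡ true → x ∈ S ⊎ isPrivate x ≡ true → ¬ Adj G y x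
    lonely-no-neighbour {x} {y} ly x∈S⊎private y~x with does≡true⇒ (lonely? y) ly | x∈S⊎private
    ... | _   , isolated , _          | inj₁ x∈S = isolated x x∈S y~x
    ... | y∈S , _        , no-private | inj₂ px
      with does≡true⇒ (any? (privateNeighbour? S x)) px
    ...   | u , x∉S , u∈S , x~u , unique with unique y y∈S (adj-sym y~x)
    ...     | refl = no-private (x , x∉S , u∈S , x~u , unique)

    ∈S⊎private : ∀ {x} → lookup S x ∨ isPrivate x ≡ true → x ∈ S ⊎ isPrivate x ≡ true
    ∈S⊎private {x} e with lookup S x in sx
    ... | true  = inj₁ (lookup⇒[]= x S sx)
    ... | false = inj₂ e

    sideSelection-independent : ∀ {side} → ProperColouring side → Independent (sideSelection side)
    sideSelection-independent {side} proper x y x∈ y∈ x~y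
      with side x in sx | side y in sy | ∈-tabulate⁻ x∈ | ∈-tabulate⁻ y∈
    ... | true  | true  | _  | _  = proper x~y (trans sx (sym sy))
    ... | false | false | _  | _  = proper x~y (trans sx (sym sy))
    ... | true  | false | Jx | Jy = lonely-no-neighbour Jy (∈S⊎private Jx) (adj-sym x~y)
    ... | false | true  | Jx | Jy = lonely-no-neighbour Jx (∈S⊎private Jy) x~y

    ∣sideSelection∣+∣sideSelection∣ : ∀ side →
      ∣ sideSelection side ∣ + ∣ sideSelection (not ∘ side) ∣ ≡ ∣ S ∣ + count isPrivate + count lonely
    ∣sideSelection∣+∣sideSelection∣ side = begin
      ∣ sideSelection side ∣ + ∣ sideSelection (not ∘ side) ∣
        ≡⟨ cong₂ _+_ (∣tabulate∣ (pick side)) (∣tabulate∣ (pick (not ∘ side))) ⟩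
      count (pick side) + count (pick (not ∘ side))
        ≡⟨ ∑-distrib-+ (𝟙 ∘ pick side) (𝟙 ∘ pick (not ∘ side)) ⟨
      ∑[ x < n ] (𝟙 (pick side x) + 𝟙 (pick (not ∘ side) x))
        ≡⟨ sum-cong-≗ (λ x → both-sides (side x) (private⇒∉ x)) ⟩
      ∑[ x < n ] (𝟙 (lookup S x) + 𝟙 (isPrivate x) + 𝟙 (lonely x))
        ≡⟨ ∑-distrib-+ (λ x → 𝟙 (lookup S x) + 𝟙 (isPrivate x)) (𝟙 ∘ lonely) ⟩
      ∑[ x < n ] (𝟙 (lookup S x) + 𝟙 (isPrivate x)) + count lonely
        ≡⟨ cong (_+ count lonely) (∑-distrib-+ (𝟙 ∘ lookup S) (𝟙 ∘ isPrivate)) ⟩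
      count (lookup S) + count isPrivate + count lonely
        ≡⟨ cong (λ k → k + count isPrivate + count lonely) (∣S∣≡count S) ⟨
      ∣ S ∣ + count isPrivate + count lonely ∎
      where
      open ≡-Reasoning
      pick : (Fin n → Bool) → Fin n → Bool
      pick side x = if side x then lookup S x ∨ isPrivate x else lonely x
      private⇒∉ : ∀ x → isPrivate x ≡ true → lookup S x ≡ false
      private⇒∉ x px = ∉⇒lookup≡false (proj₁ (proj₂ (does≡true⇒ (any? (privateNeighbour? S x)) px)))
      both-sides : ∀ a {s p l} → (p ≡ true → s ≡ false) →
        𝟙 (if a then s ∨ p else l) + 𝟙 (if not a then s ∨ p else l) ≡ 𝟙 s + 𝟙 p + 𝟙 l
      both-sides true  {true}  {true}      p⇒¬s = contradiction (p⇒¬s refl) λ ()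
      both-sides true  {true}  {false}     _    = refl
      both-sides true  {false} {true}      _    = refl
      both-sides true  {false} {false}     _    = refl
      both-sides false {true}  {true}      p⇒¬s = contradiction (p⇒¬s refl) λ ()
      both-sides false {true}  {false} {l} _    = +-comm (𝟙 l) 1
      both-sides false {false} {true}  {l} _    = +-comm (𝟙 l) 1
      both-sides false {false} {false} {l} _    = +-identityʳ (𝟙 l)

    irredundant : Fin n → Bool
    irredundant u = lookup S u ∧ not (redundant S u)

    ∣S∣≡redundancy+#irredundant : ∣ S ∣ ≡ redundancy S + count irredundant
    ∣S∣≡redundancy+#irredundant = begin
      ∣ S ∣
        ≡⟨ ∣S∣≡count S ⟩
      count (lookup S)
        ≡⟨ sum-cong-≗ (λ u → split (lookup S u) _) ⟩
      ∑[ u < n ] (𝟙 (redundant S u) + 𝟙 (irredundant u))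
        ≡⟨ ∑-distrib-+ (𝟙 ∘ redundant S) (𝟙 ∘ irredundant) ⟩
      redundancy S + count irredundant ∎
      where
      open ≡-Reasoning
      split : ∀ s d → 𝟙 s ≡ 𝟙 (s ∧ d) + 𝟙 (s ∧ not (s ∧ d))
      split false d     = refl
      split true  false = refl
      split true  true  = refl

    irredundant≤ : Dominating G S → ∀ u → 𝟙 (irredundant u) ≤ 𝟙 (hasPrivate u) + 𝟙 (lonely u)
    irredundant≤ dom u =
      bound (lookup S u) (does (dominating? G (S [ u ]≔ outside))) (hasPrivate u) (lonely u) lonely-when
      where
      bound : ∀ s d h l → (s ≡ true → d ≡ false → h ≡ false → l ≡ true) →
              𝟙 (s ∧ not (s ∧ d)) ≤ 𝟙 h + 𝟙 l
      bound false d     h     l _ = z≤n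
      bound true  true  h     l _ = z≤n
      bound true  false true  l _ = s≤s z≤n
      bound true  false false l lonely-if rewrite lonely-if refl refl refl = s≤s z≤n
      lonely-when : lookup S u ≡ true → does (dominating? G (S [ u ]≔ outside)) ≡ false →
                    hasPrivate u ≡ false → lonely u ≡ true
      lonely-when su ¬dom ¬priv = dec-true (lonely? u) (u∈S , isolated , no-private)
        where
        u∈S = lookup⇒[]= u S su
        no-private = does≡false⇒¬ (any? (λ w → privateNeighbour? S w u)) ¬priv
        isolated : NoNeighbourIn S u
        isolated
          with irredundant⇒private⊎isolated dom u∈S (does≡false⇒¬ (dominating? G (S [ u ]≔ outside)) ¬dom)
        ... | inj₁ private-neighbour = contradiction private-neighbour no-private
        ... | inj₂ no-neighbour      = no-neighbour

    #irredundant≤#private+#lonely : Dominating G S → count irredundant ≤ count isPrivate + count lonely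
    #irredundant≤#private+#lonely dom = begin
      count irredundant                              ≤⟨ ∑-mono (irredundant≤ dom) ⟩
      ∑[ u < n ] (𝟙 (hasPrivate u) + 𝟙 (lonely u)) ≡⟨ ∑-distrib-+ (𝟙 ∘ hasPrivate) (𝟙 ∘ lonely) ⟩
      count hasPrivate + count lonely                ≤⟨ +-monoˡ-≤ (count lonely) #hasPrivate≤#private ⟩
      count isPrivate + count lonely                 ∎
      where
      open ≤-Reasoning
      #hasPrivate≤#private : count hasPrivate ≤ count isPrivate
      #hasPrivate≤#private = count-range≤count-domain (privateNeighbour? S) privateNeighbour-unique

  2∣S∣≤2Γ+redundancy : ∀ {Γ S side} → IsUpperDominationNumber G Γ → ProperColouring side → Dominating G S →
                       2 * ∣ S ∣ ≤ 2 * Γ + redundancy S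
  2∣S∣≤2Γ+redundancy {Γ} {S} {side} Γ-def proper dom = begin
    2 * ∣ S ∣
      ≡⟨ cong (∣ S ∣ +_) (+-identityʳ ∣ S ∣) ⟩
    ∣ S ∣ + ∣ S ∣
      ≡⟨ cong (∣ S ∣ +_) (∣S∣≡redundancy+#irredundant S) ⟩
    ∣ S ∣ + (r + count (irredundant S))
      ≤⟨ +-monoʳ-≤ ∣ S ∣ (+-monoʳ-≤ r (#irredundant≤#private+#lonely S dom)) ⟩
    ∣ S ∣ + (r + (#private + #lonely))
      ≡⟨ rearrange ∣ S ∣ r #private #lonely ⟩
    ∣ S ∣ + #private + #lonely + r
      ≡⟨ cong (_+ r) (∣sideSelection∣+∣sideSelection∣ S side) ⟨
    ∣ J₁ ∣ + ∣ J₂ ∣ + r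
      ≤⟨ +-monoˡ-≤ r (+-mono-≤ (independent≤Γ Γ-def J₁-independent) (independent≤Γ Γ-def J₂-independent)) ⟩
    Γ + Γ + r
      ≡⟨ cong (λ k → Γ + k + r) (+-identityʳ Γ) ⟨
    2 * Γ + r ∎
    where
    open ≤-Reasoning
    open +-*-Solver using (solve; _:=_; _:+_)
    r = redundancy S
    #private = count (isPrivate S)
    #lonely = count (lonely S)
    J₁ = sideSelection S side
    J₂ = sideSelection S (not ∘ side)
    J₁-independent = sideSelection-independent S proper
    J₂-independent = sideSelection-independent S (proper-not proper)
    rearrange : ∀ s r p l → s + (r + (p + l)) ≡ s + p + l + r
    rearrange = solve 4 (λ s r p l → s :+ (r :+ (p :+ l)) := s :+ p :+ l :+ r) refl

-- Rooted trees

module _ {n} (G : Graph n) where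

  record Rooting : Set where
    field
      depth  : Fin n → ℕ
      parent : Fin n → Fin n

    -- parent is junk at the root, which the depth condition excludes from being a child.
    ChildOf : Fin n → Fin n → Set
    ChildOf c p = depth c ≡ suc (depth p) × parent c ≡ p

    field
      adj⇒child : ∀ {u v} → Adj G u v → ChildOf u v ⊎ ChildOf v u
      child⇒adj : ∀ {c p} → ChildOf c p → Adj G c p

  module _ (R : Rooting) where
    open Rooting R

    isEven : ℕ → Bool
    isEven zero    = true
    isEven (suc k) = not (isEven k)

    depth-parity-proper : ProperColouring G (isEven ∘ depth)
    depth-parity-proper u~v with adj⇒child u~v
    ... | inj₁ (du , _) = λ same → not-¬ refl (trans (sym same) (cong isEven du))
    ... | inj₂ (dv , _) = λ same → not-¬ refl (trans same (cong isEven dv))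

    module _ (S : Subset n) where

      childOf? : ∀ c p → Dec (ChildOf c p)
      childOf? c p = (depth c ℕ.≟ suc (depth p)) ×-dec (parent c ≟ p)

      EarlierSibling : Fin n → Set
      EarlierSibling c = ∃[ c′ ] toℕ c′ < toℕ c × c′ ∈ S × ChildOf c′ (parent c)

      earlierSibling? : ∀ c → Dec (EarlierSibling c)
      earlierSibling? c = any? (λ c′ → (toℕ c′ <? toℕ c) ×-dec (c′ ∈? S) ×-dec childOf? c′ (parent c))

      FirstChild : Fin n → Fin n → Set
      FirstChild c p = c ∈ S × ChildOf c p × ¬ EarlierSibling c

      first-child : ∀ {c p} → c ∈ S → ChildOf c p → ∃[ f ] FirstChild f p
      first-child {c} = descend (suc (toℕ c)) ≤-refl
        where
        descend : ∀ k {c p} → toℕ c < k → c ∈ S → ChildOf c p → ∃[ f ] FirstChild f p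
        descend (suc k) {c} c<k c∈S c◃p with earlierSibling? c
        ... | no  none                    = c , c∈S , c◃p , none
        ... | yes (c′ , c′<c , c′∈S , c′◃) =
          descend k (≤-trans c′<c (≤-pred c<k)) c′∈S (subst (ChildOf c′) (proj₂ c◃p) c′◃)

      first-child-unique : ∀ {f f′ p} → FirstChild f p → FirstChild f′ p → f ≡ f′
      first-child-unique {f} {f′} (f∈S , f◃p , f-first) (f′∈S , f′◃p , f′-first)
        with <-cmp (toℕ f) (toℕ f′)
      ... | tri< f<f′ _ _ = contradiction (f , f<f′ , f∈S , subst (ChildOf f) (sym (proj₂ f′◃p)) f◃p) f′-first
      ... | tri≈ _ f≡f′ _ = toℕ-injective f≡f′
      ... | tri> _ _ f′<f = contradiction (f′ , f′<f , f′∈S , subst (ChildOf f′) (sym (proj₂ f◃p)) f′◃p) f-first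

      switches : Fin n → Bool
      switches c = lookup S c ∧ (lookup S (parent c) ∨ not (does (earlierSibling? c)))

      colourAt : ℕ → Fin n → Bool
      colourAt zero    x = switches x
      colourAt (suc k) x = switches x xor colourAt k (parent x)

      colour : Fin n → Bool
      colour x = colourAt (depth x) x

      colour-child : ∀ {c p} → ChildOf c p → colour c ≡ switches c xor colour p
      colour-child (dc , refl) rewrite dc = refl

      colour-switch : ∀ {c p} → ChildOf c p → switches c ≡ true → colour c ≢ colour p
      colour-switch c◃p sw same = not-¬ refl (trans (sym same) (trans (colour-child c◃p) (cong (_xor _) sw)))

      colour-stay : ∀ {c p} → ChildOf c p → switches c ≡ false → colour c ≡ colour p
      colour-stay c◃p sw = trans (colour-child c◃p) (cong (_xor _) sw)

      switches-in-S : ∀ {c p} → c ∈ S → p ∈ S → ChildOf c p → switches c ≡ true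
      switches-in-S {c} c∈S p∈S (_ , refl) =
        cong₂ (λ a b → a ∧ (b ∨ not (does (earlierSibling? c)))) ([]=⇒lookup c∈S) ([]=⇒lookup p∈S)

      switches-outside-S : ∀ {c} → c ∉ S → switches c ≡ false
      switches-outside-S c∉S rewrite ∉⇒lookup≡false c∉S = refl

      switches-first : ∀ {c p} → p ∉ S → FirstChild c p → switches c ≡ true
      switches-first {c} p∉S (c∈S , (_ , refl) , first)
        rewrite []=⇒lookup c∈S | ∉⇒lookup≡false p∉S | dec-false (earlierSibling? c) first = refl

      switches-later : ∀ {c p} → p ∉ S → ChildOf c p → EarlierSibling c → switches c ≡ false
      switches-later {c} p∉S (_ , refl) earlier
        rewrite ∉⇒lookup≡false p∉S | dec-true (earlierSibling? c) earlier = ∧-zeroʳ (lookup S c)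

      colour-differs-in-S : ∀ {u v} → u ∈ S → v ∈ S → Adj G u v → colour u ≢ colour v
      colour-differs-in-S u∈S v∈S u~v with adj⇒child u~v
      ... | inj₁ u◃v = colour-switch u◃v (switches-in-S u∈S v∈S u◃v)
      ... | inj₂ v◃u = colour-switch v◃u (switches-in-S v∈S u∈S v◃u) ∘ sym

      colour-around-outsider : ∀ {w u f} → w ∉ S → u ∈ S → Adj G w u → FirstChild f w → u ≢ f →
                               colour u ≡ colour w
      colour-around-outsider {u = u} w∉S u∈S w~u first u≢f with adj⇒child w~u
      ... | inj₁ w◃u = sym (colour-stay w◃u (switches-outside-S w∉S))
      ... | inj₂ u◃w with earlierSibling? u
      ...   | yes earlier = colour-stay u◃w (switches-later w∉S u◃w earlier)
      ...   | no  none    = contradiction (first-child-unique (u∈S , u◃w , none) first) u≢f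

      outsider-neighbour : ∀ {w u} → w ∉ S → u ∈ S → Dominates G u w → Adj G w u
      outsider-neighbour w∉S u∈S (inj₁ refl) = contradiction u∈S w∉S
      outsider-neighbour w∉S u∈S (inj₂ w~u)  = w~u

      child-among : ∀ {w x y} → x ∈ S → y ∈ S → x ≢ y → Adj G w x → Adj G w y →
                    ∃[ c ] c ∈ S × ChildOf c w
      child-among {x = x} {y} x∈S y∈S x≢y w~x w~y with adj⇒child w~x | adj⇒child w~y
      ... | inj₁ (_ , px) | inj₁ (_ , py) = contradiction (trans (sym px) py) x≢y
      ... | _             | inj₂ y◃w      = y , y∈S , y◃w
      ... | inj₂ x◃w      | inj₁ _        = x , x∈S , x◃w

      -- Inside S the colouring is proper; a vertex w outside S sees its own colour on
      -- every neighbour in S except its first child in S, which has the other colour.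
      splitting : Splitting G S colour
      splitting {w} {x} {y} x∈S y∈S x≢y x▹w y▹w with w ∈? S
      ... | yes w∈S with x▹w | y▹w
      ...   | inj₁ refl | inj₁ refl = contradiction refl x≢y
      ...   | inj₁ refl | inj₂ x~y  = y , y∈S , inj₂ x~y , colour-differs-in-S y∈S x∈S (adj-sym G x~y)
      ...   | inj₂ w~x  | _         = w , w∈S , inj₁ refl , colour-differs-in-S w∈S x∈S w~x
      splitting {w} {x} {y} x∈S y∈S x≢y x▹w y▹w | no w∉S
        with outsider-neighbour w∉S x∈S x▹w | outsider-neighbour w∉S y∈S y▹w
      ... | w~x | w~y with child-among x∈S y∈S x≢y w~x w~y
      ...   | c , c∈S , c◃w with first-child c∈S c◃w
      ...     | f , first@(f∈S , f◃w , _) with x ≟ f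
      ...       | yes refl = y , y∈S , inj₂ w~y , λ same →
                  f-switches (trans (sym same) (colour-around-outsider w∉S y∈S w~y first (x≢y ∘ sym)))
        where f-switches = colour-switch f◃w (switches-first w∉S first)
      ...       | no  x≢f  = f , f∈S , inj₂ (adj-sym G (child⇒adj f◃w)) , λ same →
                  f-switches (trans same (colour-around-outsider w∉S x∈S w~x first x≢f))
        where f-switches = colour-switch f◃w (switches-first w∉S first)

-- Breadth-first search roots every tree

injective⇒surjective : ∀ {m k} → k ≤ m → (f : Fin m → Fin k) → (∀ {x y} → f x ≡ f y → x ≡ y) →
                       ∀ y → ∃[ x ] f x ≡ y
injective⇒surjective {m} {suc k} k<m f f-inj y with any? (λ x → f x ≟ y)
... | yes hit  = hit
... | no  miss = contradiction (injective⇒≤ g-inj) (<⇒≱ k<m)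
  where
  missed : ∀ x → y ≢ f x
  missed x = miss ∘ (x ,_) ∘ sym
  g : Fin m → Fin k
  g x = punchOut (missed x)
  g-inj : ∀ {x x′} → g x ≡ g x′ → x ≡ x′
  g-inj {x} {x′} e = f-inj (punchOut-injective (missed x) (missed x′) e)

module BreadthFirst {m} (G : Graph (suc m)) (connected : Connected G) where

  root : Fin (suc m)
  root = zero

  WithinDistance : ℕ → Fin (suc m) → Set
  WithinDistance zero    v = v ≡ root
  WithinDistance (suc k) v = WithinDistance k v ⊎ ∃[ u ] Adj G v u × WithinDistance k u

  withinDistance? : ∀ k v → Dec (WithinDistance k v)
  withinDistance? zero    v = v ≟ root
  withinDistance? (suc k) v = withinDistance? k v ⊎-dec any? (λ u → T? (adj G v u) ×-dec withinDistance? k u)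

  walk⇒withinDistance : ∀ {v} → Walk G v root → ∃[ k ] WithinDistance k v
  walk⇒withinDistance here = 0 , refl
  walk⇒withinDistance (step {w = u} v~u walk) with walk⇒withinDistance walk
  ... | k , near = suc k , inj₂ (u , v~u , near)

  withinDistance-mono : ∀ {j k v} → j ≤ k → WithinDistance j v → WithinDistance k v
  withinDistance-mono {zero}  {zero}  _         near = near
  withinDistance-mono {zero}  {suc k} _         near = inj₁ (withinDistance-mono z≤n near)
  withinDistance-mono {suc j} {suc k} (s≤s j≤k) (inj₁ near) = inj₁ (withinDistance-mono j≤k near)
  withinDistance-mono {suc j} {suc k} (s≤s j≤k) (inj₂ (u , v~u , near)) =
    inj₂ (u , v~u , withinDistance-mono j≤k near)

  IsDistance : Fin (suc m) → ℕ → Set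
  IsDistance v d = WithinDistance d v × (∀ {j} → j < d → ¬ WithinDistance j v)

  least-distance : ∀ k {v} → WithinDistance k v → ∃ (IsDistance v)
  least-distance zero    near = 0 , near , λ ()
  least-distance (suc k) {v} near with withinDistance? k v
  ... | yes near′ = least-distance k near′
  ... | no  far   = suc k , near , λ j<1+k near-j → far (withinDistance-mono (≤-pred j<1+k) near-j)

  distance : ∀ v → ∃ (IsDistance v)
  distance v with walk⇒withinDistance (connected v root)
  ... | k , near = least-distance k near

  depth : Fin (suc m) → ℕ
  depth v = proj₁ (distance v)

  depth-within : ∀ v → WithinDistance (depth v) v
  depth-within v = proj₁ (proj₂ (distance v))

  depth-least : ∀ {v j} → j < depth v → ¬ WithinDistance j v
  depth-least {v} = proj₂ (proj₂ (distance v))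

  depth≤ : ∀ {k v} → WithinDistance k v → depth v ≤ k
  depth≤ near = ≮⇒≥ (λ k<d → depth-least k<d near)

  depth-step : ∀ {v k} → depth v ≡ suc k → ∃[ u ] Adj G v u × depth u ≡ k
  depth-step {v} {k} dv with subst (λ d → WithinDistance d v) dv (depth-within v)
  ... | inj₁ near             = contradiction near (depth-least (subst (k <_) (sym dv) (n<1+n k)))
  ... | inj₂ (u , v~u , near) = u , v~u , ≤-antisym (depth≤ near) (≮⇒≥ shortcut)
    where
    shortcut : ¬ depth u < k
    shortcut du<k = depth-least (subst (suc (depth u) <_) (sym dv) (s≤s du<k)) (inj₂ (u , v~u , depth-within u))

  depth-nonroot : ∀ i → depth (suc i) ≢ 0
  depth-nonroot i d≡0 with () ← subst (λ d → WithinDistance d (suc i)) d≡0 (depth-within (suc i))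

  parentStep : ∀ v → depth v ≡ 0 ⊎ ∃[ u ] Adj G v u × depth v ≡ suc (depth u)
  parentStep v with depth v in dv
  ... | zero  = inj₁ refl
  ... | suc k with depth-step dv
  ...   | u , v~u , du = inj₂ (u , v~u , cong suc (sym du))

  parent : Fin (suc m) → Fin (suc m)
  parent v = [ const root , proj₁ ] (parentStep v)

  parent-spec : ∀ {v} → depth v ≢ 0 → Adj G v (parent v) × depth v ≡ suc (depth (parent v))
  parent-spec {v} d≢0 with parentStep v
  ... | inj₁ d≡0             = contradiction d≡0 d≢0
  ... | inj₂ (_ , v~u , dv) = v~u , dv

  ∈-edges : ∀ {a b} → toℕ a < toℕ b → Adj G a b → (a , b) List.∈ edges G
  ∈-edges {a} {b} a<b a~b =
    ∈-filter⁺ (λ p → let (i , j) = p in (toℕ i <? toℕ j) ×-dec T? (adj G i j))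
      (∈-concatMap⁺ (λ i → map (i ,_) (allFin (suc m)))
        (Any.map (λ { refl → ∈-map⁺ (a ,_) (∈-allFin b) }) (∈-allFin a)))
      (a<b , a~b)

  ParentEdge : Fin (suc m) → Fin (suc m) × Fin (suc m) → Set
  ParentEdge v (a , b) = (a ≡ v × b ≡ parent v) ⊎ (a ≡ parent v × b ≡ v)

  parentEdge : ∀ v → depth v ≢ 0 → ∃[ e ] e List.∈ edges G × ParentEdge v e
  parentEdge v d≢0 with parent-spec d≢0 | <-cmp (toℕ v) (toℕ (parent v))
  ... | v~p , _ | tri< v<p _ _ = (v , parent v) , ∈-edges v<p v~p , inj₁ (refl , refl)
  ... | v~p , _ | tri≈ _ v≡p _ = contradiction (toℕ-injective v≡p) (adj-irrefl G v~p)
  ... | v~p , _ | tri> _ _ p<v = (parent v , v) , ∈-edges p<v (adj-sym G v~p) , inj₂ (refl , refl)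

  no-2-cycle : ∀ {v w} → depth v ≢ 0 → depth w ≢ 0 → parent v ≡ w → parent w ≡ v → ⊥
  no-2-cycle {v} {w} dv≢0 dw≢0 pv≡w pw≡v = m≢1+n+m (depth v) (begin
    depth v                         ≡⟨ proj₂ (parent-spec dv≢0) ⟩
    suc (depth (parent v))          ≡⟨ cong (λ x → suc (depth x)) pv≡w ⟩
    suc (depth w)                   ≡⟨ cong suc (proj₂ (parent-spec dw≢0)) ⟩
    suc (suc (depth (parent w)))    ≡⟨ cong (λ x → suc (suc (depth x))) pw≡v ⟩
    suc (suc (depth v))             ∎)
    where open ≡-Reasoning

  parentEdge-injective : ∀ {v w e} → depth v ≢ 0 → depth w ≢ 0 → ParentEdge v e → ParentEdge w e → v ≡ w
  parentEdge-injective _ _ (inj₁ (refl , _)) (inj₁ (a≡w , _)) = a≡w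
  parentEdge-injective _ _ (inj₂ (_ , refl)) (inj₂ (_ , b≡w)) = b≡w
  parentEdge-injective dv≢0 dw≢0 (inj₁ (refl , b≡pv)) (inj₂ (a≡pw , b≡w)) =
    ⊥-elim (no-2-cycle dv≢0 dw≢0 (trans (sym b≡pv) b≡w) (sym a≡pw))
  parentEdge-injective dv≢0 dw≢0 (inj₂ (a≡pv , refl)) (inj₁ (a≡w , b≡pw)) =
    ⊥-elim (no-2-cycle dv≢0 dw≢0 (trans (sym a≡pv) a≡w) (sym b≡pw))

  -- With exactly m edges, the m parent edges of the non-root vertices are all the edges.
  module _ (edge-count : length (edges G) + 1 ≡ suc m) where

    length≡m : length (edges G) ≡ m
    length≡m = suc-injective (trans (+-comm 1 (length (edges G))) edge-count)

    parentEdgeIndex : Fin m → Fin (length (edges G))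
    parentEdgeIndex i = index (proj₁ (proj₂ (parentEdge (suc i) (depth-nonroot i))))

    parentEdgeIndex-injective : ∀ {i j} → parentEdgeIndex i ≡ parentEdgeIndex j → i ≡ j
    parentEdgeIndex-injective {i} {j} same
      with parentEdge (suc i) (depth-nonroot i) | parentEdge (suc j) (depth-nonroot j)
    ... | e , e∈ , i-edge | e′ , e′∈ , j-edge =
      Fin.suc-injective (parentEdge-injective (depth-nonroot i) (depth-nonroot j) i-edge
        (subst (ParentEdge (suc j)) (sym (index-injective (setoid _) e∈ e′∈ same)) j-edge))

    edge⇒parentEdge : ∀ {e} → e List.∈ edges G → ∃[ v ] depth v ≢ 0 × ParentEdge v e
    edge⇒parentEdge {e} e∈
      with injective⇒surjective (≤-reflexive length≡m) parentEdgeIndex parentEdgeIndex-injective (index e∈)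
    ... | i , hit with parentEdge (suc i) (depth-nonroot i)
    ...   | e′ , e′∈ , i-edge =
      suc i , depth-nonroot i , subst (ParentEdge (suc i)) (index-injective (setoid _) e′∈ e∈ hit) i-edge

    private
      ChildOf : Fin (suc m) → Fin (suc m) → Set
      ChildOf c p = depth c ≡ suc (depth p) × parent c ≡ p

      child-of-parent : ∀ {v} → depth v ≢ 0 → ChildOf v (parent v)
      child-of-parent dv≢0 = proj₂ (parent-spec dv≢0) , refl

      ordered-edge⇒child : ∀ {a b} → (a , b) List.∈ edges G → ChildOf a b ⊎ ChildOf b a
      ordered-edge⇒child ab∈ = parentEdge⇒child (edge⇒parentEdge ab∈)
        where
        parentEdge⇒child : ∀ {a b} → ∃[ v ] depth v ≢ 0 × ParentEdge v (a , b) → ChildOf a b ⊎ ChildOf b a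
        parentEdge⇒child (v , dv≢0 , inj₁ (a≡v , b≡pv)) =
          inj₁ (subst₂ ChildOf (sym a≡v) (sym b≡pv) (child-of-parent dv≢0))
        parentEdge⇒child (v , dv≢0 , inj₂ (a≡pv , b≡v)) =
          inj₂ (subst₂ ChildOf (sym b≡v) (sym a≡pv) (child-of-parent dv≢0))

      adj⇒child : ∀ {u v} → Adj G u v → ChildOf u v ⊎ ChildOf v u
      adj⇒child {u} {v} u~v with <-cmp (toℕ u) (toℕ v)
      ... | tri< u<v _ _ = ordered-edge⇒child (∈-edges u<v u~v)
      ... | tri≈ _ u≡v _ = contradiction (toℕ-injective u≡v) (adj-irrefl G u~v)
      ... | tri> _ _ v<u = swap (ordered-edge⇒child (∈-edges v<u (adj-sym G u~v)))

      child⇒adj : ∀ {c p} → ChildOf c p → Adj G c p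
      child⇒adj (dc , refl) = proj₁ (parent-spec (λ dc≡0 → contradiction (trans (sym dc≡0) dc) λ ()))

    rooting : Rooting G
    rooting = record { depth = depth ; parent = parent ; adj⇒child = adj⇒child ; child⇒adj = child⇒adj }

tree⇒rooting : ∀ {n} (G : Graph n) → IsTree G → Rooting G
tree⇒rooting {zero}  G (_ , edge-count) = contradiction (trans (+-comm 1 (length (edges G))) edge-count) λ ()
tree⇒rooting {suc m} G (connected , edge-count) = BreadthFirst.rooting G connected edge-count

theorem18 : (n : ℕ) (T : Graph n) → IsTree T →
    (γ Γ : ℕ) → IsDominationNumber T γ → IsUpperDominationNumber T Γ →
    ((n + 2 * γ) * numDominating T ≤ 3 * domSizeSum T)
    × (3 * domSizeSum T ≤ (n + 2 * Γ) * numDominating T)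
theorem18 n T tree γ Γ γ-def Γ-def =
  average-lower γ (All.map (λ {S} dom → 2γ+redundancy≤2∣S∣ T γ-def dom (splitting T R S)) all-dominating) ,
  average-upper Γ (All.map (2∣S∣≤2Γ+redundancy T Γ-def (depth-parity-proper T R)) all-dominating)
  where
  R = tree⇒rooting T tree
  coSize : Subset n → ℕ
  coSize S = count (not ∘ lookup S)
  size+coSize : ∀ S → ∣ S ∣ + coSize S ≡ n
  size+coSize S = trans (cong (_+ coSize S) (∣S∣≡count S)) (count+count-not (lookup S))
  open Averaging (dominatingSets T) ∣_∣ coSize (redundancy T) size+coSize
    (sum-complement≡sum-removable (dominating? T) (λ S v → dominating-⊆ T (removal-⊆ T S v)))
  all-dominating : All (Dominating T) (dominatingSets T)
  all-dominating = all-filter (dominating? T) (allSubsets n)
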